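{- $\mathbb{BT}2\cap\mathbb{SH}_c=\mathbb V(\bar{\mathbf 2})$.
   Context: A semi-Heyting algebra is an algebra $\langle A;\wedge,\vee,\to,0,1\rangle$ such that $\langle A;\wedge,\vee,0,1\rangle$ is a bounded lattice and the identities $x\wedge(x\to y)\approx x\wedge y$, $x\wedge(y\to z)\approx x\wedge((x\wedge y)\to(x\wedge z))$, $x\to x\approx1$ hold. Write $x^*:=x\to0$. $\mathbb{BT}2$ is the variety of semi-Heyting algebras satisfying $(x\to y^*)\to(x\to y)^*\approx1$; $\mathbb{SH}_c$ is the variety of semi-Heyting algebras satisfying $x\to y\approx y\to x$; $\mathbb V(\bar{\mathbf 2})$ is the variety generated by $\bar{\mathbf 2}$, the semi-Heyting algebra on the chain $0<1$ with $0\to0=1$, $0\to1=0$, $1\to0=0$, $1\to1=1$. -}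

module Defs where

open import Level using (Level; suc)
open import Data.Nat using (ℕ)
open import Data.Bool using (Bool; true; false)
open import Data.Product using (_×_; _,_)
open import Relation.Binary.PropositionalEquality using (_≡_; refl)
open import Algebra.Lattice.Structures using (IsLattice)
open import Data.Bool.Properties using (∨-∧-isLattice)

record SemiHeyting (a : Level) : Set (suc a) where
  infixr 8 _∧_
  infixr 7 _∨_
  infixr 6 _⇒_
  field
    Carrier : Set a
    _∧_ _∨_ _⇒_ : Carrier → Carrier → Carrier
    𝟎 𝟏 : Carrier
    isLattice : IsLattice (_≡_ {A = Carrier}) _∨_ _∧_
    ∧-zero : ∀ x → x ∧ 𝟎 ≡ 𝟎
    ∨-one  : ∀ x → x ∨ 𝟏 ≡ 𝟏
    SH1 : ∀ x y → x ∧ (x ⇒ y) ≡ x ∧ y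
    SH2 : ∀ x y z → x ∧ (y ⇒ z) ≡ x ∧ ((x ∧ y) ⇒ (x ∧ z))
    SH3 : ∀ x → x ⇒ x ≡ 𝟏

infixr 6 _∧ₜ_
infixr 5 _∨ₜ_
infixr 4 _⇒ₜ_
data Term : Set where
  var : ℕ → Term
  _∧ₜ_ _∨ₜ_ _⇒ₜ_ : Term → Term → Term
  0ₜ 1ₜ : Term

record Identity : Set where
  constructor _≈ₜ_
  field
    lhs rhs : Term

module _ {a : Level} (A : SemiHeyting a) where
  open SemiHeyting A

  ⟦_⟧ : Term → (ℕ → Carrier) → Carrier
  ⟦ var i ⟧ ρ = ρ i
  ⟦ s ∧ₜ t ⟧ ρ = ⟦ s ⟧ ρ ∧ ⟦ t ⟧ ρ
  ⟦ s ∨ₜ t ⟧ ρ = ⟦ s ⟧ ρ ∨ ⟦ t ⟧ ρ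
  ⟦ s ⇒ₜ t ⟧ ρ = ⟦ s ⟧ ρ ⇒ ⟦ t ⟧ ρ
  ⟦ 0ₜ ⟧ ρ = 𝟎
  ⟦ 1ₜ ⟧ ρ = 𝟏

_⊨_ : ∀ {a} → SemiHeyting a → Identity → Set a
A ⊨ (s ≈ₜ t) = ∀ (ρ : ℕ → SemiHeyting.Carrier A) → ⟦ A ⟧ s ρ ≡ ⟦ A ⟧ t ρ

x₀ x₁ : Term
x₀ = var 0
x₁ = var 1

_*ₜ : Term → Term
t *ₜ = t ⇒ₜ 0ₜ

BT2-identity : Identity
BT2-identity = ((x₀ ⇒ₜ (x₁ *ₜ)) ⇒ₜ ((x₀ ⇒ₜ x₁) *ₜ)) ≈ₜ 1ₜ

SHc-identity : Identity
SHc-identity = (x₀ ⇒ₜ x₁) ≈ₜ (x₁ ⇒ₜ x₀)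

InBT2∩SHc : ∀ {a} → SemiHeyting a → Set a
InBT2∩SHc A = (A ⊨ BT2-identity) × (A ⊨ SHc-identity)

module Two where
  open import Data.Bool using (_∧_; _∨_)
  _⇒_ : Bool → Bool → Bool
  false ⇒ false = true
  false ⇒ true  = false
  true  ⇒ false = false
  true  ⇒ true  = true

  ∧-zero : ∀ x → x ∧ false ≡ false
  ∧-zero false = refl
  ∧-zero true = refl

  ∨-one : ∀ x → x ∨ true ≡ true
  ∨-one false = refl
  ∨-one true = refl

  SH1 : ∀ x y → x ∧ (x ⇒ y) ≡ x ∧ y
  SH1 false y = refl
  SH1 true false = refl
  SH1 true true = refl

  SH2 : ∀ x y z → x ∧ (y ⇒ z) ≡ x ∧ ((x ∧ y) ⇒ (x ∧ z))
  SH2 false y z = refl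
  SH2 true false false = refl
  SH2 true false true = refl
  SH2 true true false = refl
  SH2 true true true = refl

  SH3 : ∀ x → x ⇒ x ≡ true
  SH3 false = refl
  SH3 true = refl

2̄ : SemiHeyting Level.zero
2̄ = record
  { Carrier = Bool
  ; _∧_ = Data.Bool._∧_
  ; _∨_ = Data.Bool._∨_
  ; _⇒_ = Two._⇒_
  ; 𝟎 = false
  ; 𝟏 = true
  ; isLattice = ∨-∧-isLattice
  ; ∧-zero = Two.∧-zero
  ; ∨-one = Two.∨-one
  ; SH1 = Two.SH1
  ; SH2 = Two.SH2
  ; SH3 = Two.SH3
  }
  where import Data.Bool

-- Membership in 𝕍(2̄), the variety generated by 2̄, i.e. the equational
-- class Mod(Id(2̄)): A satisfies every identity valid in 2̄.
InV2̄ : ∀ {a} → SemiHeyting a → Set a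
InV2̄ A = ∀ (e : Identity) → 2̄ ⊨ e → A ⊨ e

{-# OPTIONS --safe #-}

-- In a semi-Heyting algebra x ⇒ (x ∧ y) is a relative pseudocomplement, so the lattice
-- reduct is a Heyting algebra.  In BT2 ∩ SH_c, BT2 at y = 0 together with commutativity
-- gives x ⇒ x** = 𝟏 = x** ⇒ x, hence x** = x, and then the Heyting law ¬¬(¬x ∨ x) = 𝟏
-- becomes x* ∨ x = 𝟏; moreover 𝟎 ⇒ 𝟏 = 𝟏 ⇒ 𝟎 = 𝟎, so {𝟎, 𝟏} is a copy of 2̄.
-- An identity of 2̄ is then verified one variable at a time, after setting the variables
-- not occurring in it to 𝟎: by SH2, c ∧ - respects all operations, so relative to the
-- value c of a variable (resp. to c*) that value may be replaced by 𝟏 (resp. 𝟎), and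
-- since c* ∨ c = 𝟏 the two halves determine the result.  Once all variables are 𝟎 or 𝟏
-- the identity is computed in 2̄.

module Submission where

open import Defs
open import Level using (Level)
open import Function.Bundles using (_⇔_; mk⇔)
open import Function.Base using (_∘_)
open import Data.Bool using (Bool; true; false) renaming (_∧_ to _∧ᵇ_; _∨_ to _∨ᵇ_)
open import Data.Nat using (ℕ; zero; suc; _⊔_; z≤n) renaming (_≤_ to _≤ℕ_; _<_ to _<ℕ_)
open import Data.Nat.Properties
  using (_≟_; _<?_; ≤∧≢⇒<; <⇒≱; m≤m⊔n; m≤n⊔m; m⊔n≤o⇒m≤o; m⊔n≤o⇒n≤o; ≤-refl)
open import Data.Product using (∃; _,_; proj₁; proj₂)
open import Data.Empty using (⊥-elim)
open import Relation.Nullary using (yes; no)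
open import Relation.Binary.PropositionalEquality
  using (_≡_; refl; sym; trans; cong; cong₂; ≢-sym; module ≡-Reasoning)
open import Relation.Binary.Bundles using (Poset)
open import Relation.Binary.Lattice.Bundles using (HeytingAlgebra)
open import Relation.Binary.Lattice.Definitions using (Exponential)
open import Algebra.Lattice.Structures using (IsLattice)
open import Algebra.Lattice.Bundles using (Lattice)
import Algebra.Lattice.Properties.Lattice as LatticeProperties
import Relation.Binary.Lattice.Properties.HeytingAlgebra as HeytingAlgebraProperties
import Relation.Binary.Lattice.Properties.DistributiveLattice as DistributiveLatticeProperties
import Relation.Binary.Lattice.Properties.BoundedLattice as BoundedLatticeProperties
import Relation.Binary.Lattice.Properties.BoundedJoinSemilattice as BoundedJoinSemilatticeProperties
open import Algebra.Bundles using (IdempotentCommutativeMonoid)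
import Algebra.Properties.IdempotentCommutativeMonoid as IdempotentCommutativeMonoidProperties

module SemiHeytingProperties {a : Level} (A : SemiHeyting a) where
  open SemiHeyting A
  open IsLattice isLattice using (∧-comm; ∧-assoc; ∧-absorbs-∨)

  lattice : Lattice a a
  lattice = record { isLattice = isLattice }

  open LatticeProperties lattice
    using (∧-isSemigroup; poset; ∨-∧-isOrderTheoreticLattice)
  open LatticeProperties lattice public using (∧-idem)
  open Poset poset public using (_≤_; antisym)
  open ≡-Reasoning

  ∧-identityʳ : ∀ x → x ∧ 𝟏 ≡ x
  ∧-identityʳ x = trans (cong (x ∧_) (sym (∨-one x))) (∧-absorbs-∨ x 𝟏)

  ∧-identityˡ : ∀ x → 𝟏 ∧ x ≡ x
  ∧-identityˡ x = trans (∧-comm 𝟏 x) (∧-identityʳ x)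

  ∧-zeroˡ : ∀ x → 𝟎 ∧ x ≡ 𝟎
  ∧-zeroˡ x = trans (∧-comm 𝟎 x) (∧-zero x)

  _* : Carrier → Carrier
  x * = x ⇒ 𝟎

  ∧-complementʳ : ∀ x → x ∧ x * ≡ 𝟎
  ∧-complementʳ x = trans (SH1 x 𝟎) (∧-zero x)

  ∧-complementˡ : ∀ x → x * ∧ x ≡ 𝟎
  ∧-complementˡ x = trans (∧-comm (x *) x) (∧-complementʳ x)

  ⇒-identityˡ : ∀ x → 𝟏 ⇒ x ≡ x
  ⇒-identityˡ x = begin
    𝟏 ⇒ x       ≡⟨ ∧-identityˡ (𝟏 ⇒ x) ⟨
    𝟏 ∧ (𝟏 ⇒ x) ≡⟨ SH1 𝟏 x ⟩
    𝟏 ∧ x       ≡⟨ ∧-identityˡ x ⟩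
    x           ∎

  ⇒≡𝟏⇒≤ : ∀ {x y} → x ⇒ y ≡ 𝟏 → x ≤ y
  ⇒≡𝟏⇒≤ {x} {y} x⇒y≡𝟏 = begin
    x             ≡⟨ ∧-identityʳ x ⟨
    x ∧ 𝟏         ≡⟨ cong (x ∧_) x⇒y≡𝟏 ⟨
    x ∧ (x ⇒ y)   ≡⟨ SH1 x y ⟩
    x ∧ y         ∎

  _⇒ᴴ_ : Carrier → Carrier → Carrier
  x ⇒ᴴ y = x ⇒ (x ∧ y)

  ⇒ᴴ-exponential : Exponential _≤_ _∧_ _⇒ᴴ_
  ⇒ᴴ-exponential w x y = transpose-⇒ᴴ , transpose-∧
    where
    transpose-⇒ᴴ : w ∧ x ≤ y → w ≤ x ⇒ᴴ y
    transpose-⇒ᴴ w∧x≤y = sym (begin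
      w ∧ (x ⇒ (x ∧ y))               ≡⟨ SH2 w x (x ∧ y) ⟩
      w ∧ ((w ∧ x) ⇒ (w ∧ (x ∧ y)))   ≡⟨ cong (λ z → w ∧ ((w ∧ x) ⇒ z)) (∧-assoc w x y) ⟨
      w ∧ ((w ∧ x) ⇒ ((w ∧ x) ∧ y))   ≡⟨ cong (λ z → w ∧ ((w ∧ x) ⇒ z)) w∧x≤y ⟨
      w ∧ ((w ∧ x) ⇒ (w ∧ x))         ≡⟨ cong (w ∧_) (SH3 (w ∧ x)) ⟩
      w ∧ 𝟏                           ≡⟨ ∧-identityʳ w ⟩
      w                               ∎)

    transpose-∧ : w ≤ x ⇒ᴴ y → w ∧ x ≤ y
    transpose-∧ w≤x⇒ᴴy = begin
      w ∧ x                     ≡⟨ cong (_∧ x) w≤x⇒ᴴy ⟩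
      (w ∧ (x ⇒ᴴ y)) ∧ x        ≡⟨ ∧-assoc w (x ⇒ᴴ y) x ⟩
      w ∧ ((x ⇒ᴴ y) ∧ x)        ≡⟨ cong (w ∧_) (∧-comm (x ⇒ᴴ y) x) ⟩
      w ∧ (x ∧ (x ⇒ᴴ y))        ≡⟨ cong (w ∧_) (SH1 x (x ∧ y)) ⟩
      w ∧ (x ∧ (x ∧ y))         ≡⟨ cong (w ∧_) (∧-assoc x x y) ⟨
      w ∧ ((x ∧ x) ∧ y)         ≡⟨ cong (λ z → w ∧ (z ∧ y)) (∧-idem x) ⟩
      w ∧ (x ∧ y)               ≡⟨ ∧-assoc w x y ⟨
      (w ∧ x) ∧ y               ∎

  heytingAlgebra : HeytingAlgebra a a a
  heytingAlgebra = record
    { isHeytingAlgebra = record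
      { isBoundedLattice = record
        { isLattice = ∨-∧-isOrderTheoreticLattice
        ; maximum   = λ x → sym (∧-identityʳ x)
        ; minimum   = λ x → sym (∧-zeroˡ x)
        }
      ; exponential = ⇒ᴴ-exponential
      }
    }

  open HeytingAlgebraProperties heytingAlgebra public using (∧-distribˡ-∨; ¬_; weak-lem)
  open HeytingAlgebraProperties heytingAlgebra using (distributiveLattice)
  open DistributiveLatticeProperties distributiveLattice using (∧-distribʳ-∨)
  open BoundedLatticeProperties (HeytingAlgebra.boundedLattice heytingAlgebra)
    public using (∨-zeroˡ)
  open BoundedJoinSemilatticeProperties (HeytingAlgebra.boundedJoinSemilattice heytingAlgebra)
    public using () renaming (identityˡ to ∨-identityˡ)

  ¬≡* : ∀ x → ¬ x ≡ x *
  ¬≡* x = cong (x ⇒_) (∧-zero x)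

  ∧-idempotentCommutativeMonoid : IdempotentCommutativeMonoid a a
  ∧-idempotentCommutativeMonoid = record
    { isIdempotentCommutativeMonoid = record
      { isCommutativeMonoid = record
        { isMonoid = record
          { isSemigroup = ∧-isSemigroup
          ; identity    = ∧-identityˡ , ∧-identityʳ
          }
        ; comm = ∧-comm
        }
      ; idem = ∧-idem
      }
    }

  open IdempotentCommutativeMonoidProperties ∧-idempotentCommutativeMonoid
    public using () renaming (∙-distrˡ-∙ to ∧-distribˡ-∧)

  ∧-jointlyInjective : ∀ {c d x y} → c ∨ d ≡ 𝟏 → c ∧ x ≡ c ∧ y → d ∧ x ≡ d ∧ y → x ≡ y
  ∧-jointlyInjective {c} {d} {x} {y} c∨d≡𝟏 c∧x≡c∧y d∧x≡d∧y = begin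
    x                   ≡⟨ ∧-identityˡ x ⟨
    𝟏 ∧ x               ≡⟨ cong (_∧ x) c∨d≡𝟏 ⟨
    (c ∨ d) ∧ x         ≡⟨ ∧-distribʳ-∨ x c d ⟩
    c ∧ x ∨ d ∧ x       ≡⟨ cong₂ _∨_ c∧x≡c∧y d∧x≡d∧y ⟩
    c ∧ y ∨ d ∧ y       ≡⟨ ∧-distribʳ-∨ y c d ⟨
    (c ∨ d) ∧ y         ≡⟨ cong (_∧ y) c∨d≡𝟏 ⟩
    𝟏 ∧ y               ≡⟨ ∧-identityˡ y ⟩
    y                   ∎

varBound : Term → ℕ
varBound (var i)  = suc i
varBound (s ∧ₜ t) = varBound s ⊔ varBound t
varBound (s ∨ₜ t) = varBound s ⊔ varBound t
varBound (s ⇒ₜ t) = varBound s ⊔ varBound t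
varBound 0ₜ       = 0
varBound 1ₜ       = 0

module TermProperties {a : Level} (A : SemiHeyting a) where
  open SemiHeyting A
  open SemiHeytingProperties A
  open ≡-Reasoning

  ⟦⟧-local : ∀ t {n ρ ρ′} → varBound t ≤ℕ n → (∀ i → i <ℕ n → ρ i ≡ ρ′ i) →
             ⟦ A ⟧ t ρ ≡ ⟦ A ⟧ t ρ′
  ⟦⟧-local (var i) i<n ρ≗ρ′ = ρ≗ρ′ i i<n
  ⟦⟧-local (s ∧ₜ t) b ρ≗ρ′ =
    cong₂ _∧_ (⟦⟧-local s (m⊔n≤o⇒m≤o _ _ b) ρ≗ρ′) (⟦⟧-local t (m⊔n≤o⇒n≤o _ _ b) ρ≗ρ′)
  ⟦⟧-local (s ∨ₜ t) b ρ≗ρ′ =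
    cong₂ _∨_ (⟦⟧-local s (m⊔n≤o⇒m≤o _ _ b) ρ≗ρ′) (⟦⟧-local t (m⊔n≤o⇒n≤o _ _ b) ρ≗ρ′)
  ⟦⟧-local (s ⇒ₜ t) b ρ≗ρ′ =
    cong₂ _⇒_ (⟦⟧-local s (m⊔n≤o⇒m≤o _ _ b) ρ≗ρ′) (⟦⟧-local t (m⊔n≤o⇒n≤o _ _ b) ρ≗ρ′)
  ⟦⟧-local 0ₜ _ _ = refl
  ⟦⟧-local 1ₜ _ _ = refl

  ⟦⟧-relative-cong : ∀ c t {ρ ρ′} → (∀ i → c ∧ ρ i ≡ c ∧ ρ′ i) →
                     c ∧ ⟦ A ⟧ t ρ ≡ c ∧ ⟦ A ⟧ t ρ′
  ⟦⟧-relative-cong c (var i) ρ≗ρ′ = ρ≗ρ′ i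
  ⟦⟧-relative-cong c (s ∧ₜ t) {ρ} {ρ′} ρ≗ρ′ = begin
    c ∧ (⟦ A ⟧ s ρ ∧ ⟦ A ⟧ t ρ)            ≡⟨ ∧-distribˡ-∧ c _ _ ⟩
    (c ∧ ⟦ A ⟧ s ρ) ∧ (c ∧ ⟦ A ⟧ t ρ)
      ≡⟨ cong₂ _∧_ (⟦⟧-relative-cong c s ρ≗ρ′) (⟦⟧-relative-cong c t ρ≗ρ′) ⟩
    (c ∧ ⟦ A ⟧ s ρ′) ∧ (c ∧ ⟦ A ⟧ t ρ′)    ≡⟨ ∧-distribˡ-∧ c _ _ ⟨
    c ∧ (⟦ A ⟧ s ρ′ ∧ ⟦ A ⟧ t ρ′)          ∎
  ⟦⟧-relative-cong c (s ∨ₜ t) {ρ} {ρ′} ρ≗ρ′ = begin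
    c ∧ (⟦ A ⟧ s ρ ∨ ⟦ A ⟧ t ρ)            ≡⟨ ∧-distribˡ-∨ c _ _ ⟩
    c ∧ ⟦ A ⟧ s ρ ∨ c ∧ ⟦ A ⟧ t ρ
      ≡⟨ cong₂ _∨_ (⟦⟧-relative-cong c s ρ≗ρ′) (⟦⟧-relative-cong c t ρ≗ρ′) ⟩
    c ∧ ⟦ A ⟧ s ρ′ ∨ c ∧ ⟦ A ⟧ t ρ′        ≡⟨ ∧-distribˡ-∨ c _ _ ⟨
    c ∧ (⟦ A ⟧ s ρ′ ∨ ⟦ A ⟧ t ρ′)          ∎
  ⟦⟧-relative-cong c (s ⇒ₜ t) {ρ} {ρ′} ρ≗ρ′ = begin
    c ∧ (⟦ A ⟧ s ρ ⇒ ⟦ A ⟧ t ρ)                 ≡⟨ SH2 c _ _ ⟩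
    c ∧ ((c ∧ ⟦ A ⟧ s ρ) ⇒ (c ∧ ⟦ A ⟧ t ρ))
      ≡⟨ cong₂ (λ u v → c ∧ (u ⇒ v)) (⟦⟧-relative-cong c s ρ≗ρ′) (⟦⟧-relative-cong c t ρ≗ρ′) ⟩
    c ∧ ((c ∧ ⟦ A ⟧ s ρ′) ⇒ (c ∧ ⟦ A ⟧ t ρ′))   ≡⟨ SH2 c _ _ ⟨
    c ∧ (⟦ A ⟧ s ρ′ ⇒ ⟦ A ⟧ t ρ′)               ∎
  ⟦⟧-relative-cong c 0ₜ _ = refl
  ⟦⟧-relative-cong c 1ₜ _ = refl

  embed : Bool → Carrier
  embed false = 𝟎
  embed true  = 𝟏

  embed-∧ : ∀ x y → embed x ∧ embed y ≡ embed (x ∧ᵇ y)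
  embed-∧ false y = ∧-zeroˡ (embed y)
  embed-∧ true  y = ∧-identityˡ (embed y)

  embed-∨ : ∀ x y → embed x ∨ embed y ≡ embed (x ∨ᵇ y)
  embed-∨ false y = ∨-identityˡ (embed y)
  embed-∨ true  y = ∨-zeroˡ (embed y)

  module _ (𝟎⇒𝟏≡𝟎 : 𝟎 ⇒ 𝟏 ≡ 𝟎) where

    embed-⇒ : ∀ x y → embed x ⇒ embed y ≡ embed (x Two.⇒ y)
    embed-⇒ false false = SH3 𝟎
    embed-⇒ false true  = 𝟎⇒𝟏≡𝟎
    embed-⇒ true  false = ⇒-identityˡ 𝟎
    embed-⇒ true  true  = SH3 𝟏

    ⟦⟧-embed : ∀ t σ → ⟦ A ⟧ t (embed ∘ σ) ≡ embed (⟦ 2̄ ⟧ t σ)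
    ⟦⟧-embed (var i)  σ = refl
    ⟦⟧-embed (s ∧ₜ t) σ =
      trans (cong₂ _∧_ (⟦⟧-embed s σ) (⟦⟧-embed t σ)) (embed-∧ (⟦ 2̄ ⟧ s σ) (⟦ 2̄ ⟧ t σ))
    ⟦⟧-embed (s ∨ₜ t) σ =
      trans (cong₂ _∨_ (⟦⟧-embed s σ) (⟦⟧-embed t σ)) (embed-∨ (⟦ 2̄ ⟧ s σ) (⟦ 2̄ ⟧ t σ))
    ⟦⟧-embed (s ⇒ₜ t) σ =
      trans (cong₂ _⇒_ (⟦⟧-embed s σ) (⟦⟧-embed t σ)) (embed-⇒ (⟦ 2̄ ⟧ s σ) (⟦ 2̄ ⟧ t σ))
    ⟦⟧-embed 0ₜ       σ = refl
    ⟦⟧-embed 1ₜ       σ = refl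

module _ {a : Level} (A : SemiHeyting a) where
  open SemiHeyting A
  open SemiHeytingProperties A
  open TermProperties A

  _[_≔_] : (ℕ → Carrier) → ℕ → Carrier → ℕ → Carrier
  (ρ [ k ≔ v ]) i with i ≟ k
  ... | yes _ = v
  ... | no  _ = ρ i

  []≔-relative : ∀ {c ρ k v} → c ∧ ρ k ≡ c ∧ v → ∀ i → c ∧ ρ i ≡ c ∧ (ρ [ k ≔ v ]) i
  []≔-relative {k = k} c∧ρk≡c∧v i with i ≟ k
  ... | yes refl = c∧ρk≡c∧v
  ... | no  _    = refl

  _↾_ : (ℕ → Carrier) → ℕ → ℕ → Carrier
  (ρ ↾ n) i with i <? n
  ... | yes _ = ρ i
  ... | no  _ = 𝟎

  ↾-agrees : ∀ {ρ n} i → i <ℕ n → ρ i ≡ (ρ ↾ n) i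
  ↾-agrees {n = n} i i<n with i <? n
  ... | yes _   = refl
  ... | no  i≮n = ⊥-elim (i≮n i<n)

  IsBit : Carrier → Set a
  IsBit x = ∃ λ b → x ≡ embed b

  BitsFrom : ℕ → (ℕ → Carrier) → Set a
  BitsFrom k ρ = ∀ i → k ≤ℕ i → IsBit (ρ i)

  []≔-BitsFrom : ∀ {ρ k v} → IsBit v → BitsFrom (suc k) ρ → BitsFrom k (ρ [ k ≔ v ])
  []≔-BitsFrom {k = k} v-bit bits i k≤i with i ≟ k
  ... | yes _   = v-bit
  ... | no  i≢k = bits i (≤∧≢⇒< k≤i (≢-sym i≢k))

  ↾-BitsFrom : ∀ ρ n → BitsFrom n (ρ ↾ n)
  ↾-BitsFrom ρ n i n≤i with i <? n
  ... | yes i<n = ⊥-elim (<⇒≱ i<n n≤i)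
  ... | no  _   = false , refl

  module _ (𝟎⇒𝟏≡𝟎 : 𝟎 ⇒ 𝟏 ≡ 𝟎) (∨-complementˡ : ∀ x → x * ∨ x ≡ 𝟏)
           {s t : Term} (2̄⊨s≈t : 2̄ ⊨ (s ≈ₜ t)) where
    open ≡-Reasoning

    ≈-on-BitsFrom : ∀ k ρ → BitsFrom k ρ → ⟦ A ⟧ s ρ ≡ ⟦ A ⟧ t ρ
    ≈-on-BitsFrom zero ρ bits = begin
      ⟦ A ⟧ s ρ                 ≡⟨ ⟦⟧-local s ≤-refl (λ i _ → ρ≗embed∘σ i) ⟩
      ⟦ A ⟧ s (embed ∘ σ)       ≡⟨ ⟦⟧-embed 𝟎⇒𝟏≡𝟎 s σ ⟩
      embed (⟦ 2̄ ⟧ s σ)         ≡⟨ cong embed (2̄⊨s≈t σ) ⟩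
      embed (⟦ 2̄ ⟧ t σ)         ≡⟨ ⟦⟧-embed 𝟎⇒𝟏≡𝟎 t σ ⟨
      ⟦ A ⟧ t (embed ∘ σ)       ≡⟨ ⟦⟧-local t ≤-refl (λ i _ → ρ≗embed∘σ i) ⟨
      ⟦ A ⟧ t ρ                 ∎
      where
      σ : ℕ → Bool
      σ i = proj₁ (bits i z≤n)
      ρ≗embed∘σ : ∀ i → ρ i ≡ embed (σ i)
      ρ≗embed∘σ i = proj₂ (bits i z≤n)
    ≈-on-BitsFrom (suc k) ρ bits =
      ∧-jointlyInjective (∨-complementˡ c)
        (≈-relative-to (c *) (false , refl) (trans (∧-complementˡ c) (sym (∧-zero (c *)))))
        (≈-relative-to c (true , refl) (trans (∧-idem c) (sym (∧-identityʳ c))))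
      where
      c : Carrier
      c = ρ k
      ≈-relative-to : ∀ d {v} → IsBit v → d ∧ c ≡ d ∧ v → d ∧ ⟦ A ⟧ s ρ ≡ d ∧ ⟦ A ⟧ t ρ
      ≈-relative-to d {v} v-bit d∧c≡d∧v = begin
        d ∧ ⟦ A ⟧ s ρ               ≡⟨ ⟦⟧-relative-cong d s ([]≔-relative d∧c≡d∧v) ⟩
        d ∧ ⟦ A ⟧ s (ρ [ k ≔ v ])
          ≡⟨ cong (d ∧_) (≈-on-BitsFrom k (ρ [ k ≔ v ]) ([]≔-BitsFrom v-bit bits)) ⟩
        d ∧ ⟦ A ⟧ t (ρ [ k ≔ v ])   ≡⟨ ⟦⟧-relative-cong d t ([]≔-relative d∧c≡d∧v) ⟨
        d ∧ ⟦ A ⟧ t ρ               ∎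

    complemented⇒⊨ : A ⊨ (s ≈ₜ t)
    complemented⇒⊨ ρ = begin
      ⟦ A ⟧ s ρ          ≡⟨ ⟦⟧-local s (m≤m⊔n (varBound s) (varBound t)) ↾-agrees ⟩
      ⟦ A ⟧ s (ρ ↾ n)    ≡⟨ ≈-on-BitsFrom n (ρ ↾ n) (↾-BitsFrom ρ n) ⟩
      ⟦ A ⟧ t (ρ ↾ n)    ≡⟨ ⟦⟧-local t (m≤n⊔m (varBound s) (varBound t)) ↾-agrees ⟨
      ⟦ A ⟧ t ρ          ∎
      where
      n : ℕ
      n = varBound s ⊔ varBound t

  complemented⇒InV2̄ : 𝟎 ⇒ 𝟏 ≡ 𝟎 → (∀ x → x * ∨ x ≡ 𝟏) → InV2̄ A
  complemented⇒InV2̄ 𝟎⇒𝟏≡𝟎 ∨-complementˡ (s ≈ₜ t) = complemented⇒⊨ 𝟎⇒𝟏≡𝟎 ∨-complementˡ {s} {t}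

module BT2∩SHcProperties {a : Level} (A : SemiHeyting a)
         (bt2 : A ⊨ BT2-identity) (shc : A ⊨ SHc-identity) where
  open SemiHeyting A
  open SemiHeytingProperties A
  open ≡-Reasoning

  [_,_] : Carrier → Carrier → ℕ → Carrier
  [ x , y ] zero    = x
  [ x , y ] (suc _) = y

  ⇒-comm : ∀ x y → x ⇒ y ≡ y ⇒ x
  ⇒-comm x y = shc [ x , y ]

  ⇒-identityʳ : ∀ x → x ⇒ 𝟏 ≡ x
  ⇒-identityʳ x = trans (⇒-comm x 𝟏) (⇒-identityˡ x)

  𝟎⇒𝟏≡𝟎 : 𝟎 ⇒ 𝟏 ≡ 𝟎
  𝟎⇒𝟏≡𝟎 = ⇒-identityʳ 𝟎

  x⇒x**≡𝟏 : ∀ x → x ⇒ x * * ≡ 𝟏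
  x⇒x**≡𝟏 x = begin
    x ⇒ x * *                  ≡⟨ cong (_⇒ x * *) (⇒-identityʳ x) ⟨
    (x ⇒ 𝟏) ⇒ x * *            ≡⟨ cong (λ z → (x ⇒ z) ⇒ x * *) (SH3 𝟎) ⟨
    (x ⇒ 𝟎 *) ⇒ (x ⇒ 𝟎) *      ≡⟨ bt2 [ x , 𝟎 ] ⟩
    𝟏                          ∎

  *-involutive : ∀ x → x * * ≡ x
  *-involutive x =
    antisym (⇒≡𝟏⇒≤ (trans (⇒-comm (x * *) x) (x⇒x**≡𝟏 x))) (⇒≡𝟏⇒≤ (x⇒x**≡𝟏 x))

  ∨-complementˡ : ∀ x → x * ∨ x ≡ 𝟏
  ∨-complementˡ x = begin
    x * ∨ x               ≡⟨ *-involutive (x * ∨ x) ⟨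
    (x * ∨ x) * *         ≡⟨ cong _* (¬≡* (x * ∨ x)) ⟨
    (¬ (x * ∨ x)) *       ≡⟨ ¬≡* (¬ (x * ∨ x)) ⟨
    ¬ ¬ (x * ∨ x)         ≡⟨ cong (λ z → ¬ ¬ (z ∨ x)) (¬≡* x) ⟨
    ¬ ¬ (¬ x ∨ x)         ≡⟨ weak-lem ⟩
    𝟏                     ∎

2̄⊨BT2 : 2̄ ⊨ BT2-identity
2̄⊨BT2 ρ with ρ 0 | ρ 1
... | false | false = refl
... | false | true  = refl
... | true  | false = refl
... | true  | true  = refl

2̄⊨SHc : 2̄ ⊨ SHc-identity
2̄⊨SHc ρ with ρ 0 | ρ 1
... | false | false = refl
... | false | true  = refl
... | true  | false = refl
... | true  | true  = refl

theorem7p6 : ∀ {a : Level} (A : SemiHeyting a) → InBT2∩SHc A ⇔ InV2̄ A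
theorem7p6 A = mk⇔ BT2∩SHc⇒V2̄ V2̄⇒BT2∩SHc
  where
  V2̄⇒BT2∩SHc : InV2̄ A → InBT2∩SHc A
  V2̄⇒BT2∩SHc A∈V2̄ = A∈V2̄ BT2-identity 2̄⊨BT2 , A∈V2̄ SHc-identity 2̄⊨SHc


  BT2∩SHc⇒V2̄ : InBT2∩SHc A → InV2̄ A
  BT2∩SHc⇒V2̄ (bt2 , shc) = complemented⇒InV2̄ A 𝟎⇒𝟏≡𝟎 ∨-complementˡ
    where open BT2∩SHcProperties A bt2 shc
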